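{- Let $s=2k>2$ and let $\alpha(s)$ be the $s$-abacus defined below. Fix an integer $j$ with $1<j<2k-3$. Then: (1) there is a bead in row $j$ of runner $0$ if and only if there is a bead in row $j-1$ of runner $1$; (2) there is a bead in row $j$ of runner $2k-1$ if and only if there is a bead in row $j-1$ of runner $2k-2$; (3) there is a spacer in row $j$ of runner $0$ if and only if there is a spacer in row $j+1$ of runner $1$; (4) there is a spacer in row $j$ of runner $2k-1$ if and only if there is a spacer in row $j+1$ of runner $2k-2$.
   Context: An $s$-abacus here is an array with runners (columns) indexed $0\le i\le s-1$ from left to right and rows indexed from bottom to top, each position holding either a bead or a spacer; the position in runner $i$, row $j$ corresponds to the integer $i+js$. For $s=2k>2$, $\alpha(s)$ is the $s$-abacus with $s$ runners and $s-2$ rows (rows $0\le j\le 2k-3$) defined as follows: for each $0\le i\le k-1$, runners $i$ and $2k-1-i$ are identical and consist of beads in rows $0,1,\dots,i-1$, followed in rows $i,i+1,\dots$ by alternately a spacer, a bead, a spacer, a bead, $\dots$ until the runner contains $k-1$ beads in total, with spacers in all remaining rows up to row $2k-3$. -}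

module Defs where

open import Data.Nat using (ℕ; zero; suc; _+_; _*_; _∸_; _<ᵇ_)
open import Data.Bool using (Bool; true; false; if_then_else_)

data Position : Set where
  bead spacer : Position

-- An s-abacus: runner index i (0 ≤ i ≤ s-1), row index j (from the bottom);
-- position (i , j) corresponds to the integer i + j s.
Abacus : Set
Abacus = ℕ → ℕ → Position

altTail : ℕ → ℕ → Position
altTail zero    t                 = spacer
altTail (suc b) zero              = spacer
altTail (suc b) (suc zero)        = bead
altTail (suc b) (suc (suc t))     = altTail b t

-- Runner i (0 ≤ i ≤ k-1) of α(2k): beads in rows 0..i-1, then alternately
-- spacer, bead, ... until the runner has k-1 beads in total, then spacers.
baseRunner : ℕ → ℕ → ℕ → Position
baseRunner k i r =
  if r <ᵇ i then bead else altTail ((k ∸ 1) ∸ i) (r ∸ i)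

-- α(2k): runners i and 2k-1-i are identical (0 ≤ i ≤ k-1); rows 0 .. 2k-3.
-- Positions outside the abacus (runner ≥ 2k or row > 2k-3) are spacers.
α : ℕ → Abacus
α k c r =
  if (c <ᵇ 2 * k) Data.Bool.∧ (r <ᵇ (2 * k ∸ 2))
  then (if c <ᵇ k then baseRunner k c r else baseRunner k ((2 * k ∸ 1) ∸ c) r)
  else spacer

-- Runners 0 and 1 of α(2k) both end in the same alternating pattern
-- spacer, bead, spacer, …, but runner 1 starts it one row later and places
-- one bead fewer.  So, away from the boundary rows, shifting runner 1 down by
-- one row reproduces runner 0 exactly, while shifting it up by one row
-- reproduces runner 0 up to period 2.  Runners 2k-1 and 2k-2 are copies of
-- runners 0 and 1.
module Submission where

open import Defs
open import Data.Nat using (ℕ; zero; suc; _+_; _*_; _∸_; _<_; _≤_; z≤n; s≤s; s≤s⁻¹; _<ᵇ_)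
open import Data.Nat.Properties
  using (<⇒<ᵇ; ≤-trans; m≤m+n; m∸[m∸n]≡n; m+n∸m≡n; ∸-monoʳ-≤; +-comm; +-suc; +-identityʳ; m∸n≤m; n≤1+n; m≤n+m)
open import Data.Bool using (true; false)
open import Data.Bool.Properties using (T-≡)
open import Data.Product using (_×_; _,_)
open import Relation.Binary.PropositionalEquality
  using (_≡_; refl; sym; trans; cong; subst; module ≡-Reasoning)
open import Function.Bundles using (_⇔_; mk⇔; Equivalence)

<ᵇ-true : ∀ {m n} → m < n → (m <ᵇ n) ≡ true
<ᵇ-true m<n = Equivalence.to T-≡ (<⇒<ᵇ m<n)

<ᵇ-false : ∀ {m n} → n ≤ m → (m <ᵇ n) ≡ false
<ᵇ-false z≤n       = refl
<ᵇ-false (s≤s n≤m) = <ᵇ-false n≤m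

altTail-suc : ∀ b t → t ≤ b + b → altTail (suc b) t ≡ altTail b t
altTail-suc zero    zero          _ = refl
altTail-suc (suc b) zero          _ = refl
altTail-suc (suc b) (suc zero)    _ = refl
altTail-suc (suc b) (suc (suc t)) t≤ =
  altTail-suc b t (s≤s⁻¹ (subst (suc t ≤_) (+-suc b b) (s≤s⁻¹ t≤)))

α-inside : ∀ k c r → c < k → r < 2 * k ∸ 2 → α k c r ≡ baseRunner k c r
α-inside k c r c<k r<
  rewrite <ᵇ-true (≤-trans c<k (m≤m+n k (k + 0))) | <ᵇ-true r< | <ᵇ-true c<k = refl

k≤2k∸1∸c : ∀ {k c} → c < k → k ≤ 2 * k ∸ 1 ∸ c
k≤2k∸1∸c {suc m} {c} c<k = ≤-trans (s≤s (m≤m+n m 0))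
  (subst (_≤ m + suc (m + 0) ∸ c) (m+n∸m≡n m (suc (m + 0))) (∸-monoʳ-≤ _ (s≤s⁻¹ c<k)))

α-mirror : ∀ k c r → c < k → α k (2 * k ∸ 1 ∸ c) r ≡ α k c r
α-mirror k@(suc m) c r c<k
  rewrite <ᵇ-true (s≤s (m∸n≤m (m + suc (m + 0)) c))
        | <ᵇ-true (≤-trans c<k (m≤m+n k (k + 0)))
        | <ᵇ-false (k≤2k∸1∸c c<k)
        | <ᵇ-true c<k
        | m∸[m∸n]≡n (≤-trans (s≤s⁻¹ c<k) (m≤m+n m (suc (m + 0)))) = refl

2*[2+m]∸2 : ∀ m → 2 * (2 + m) ∸ 2 ≡ suc (suc (m + m))
2*[2+m]∸2 m = begin
  m + suc (suc (m + 0))  ≡⟨ cong (λ n → m + suc (suc n)) (+-identityʳ m) ⟩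
  m + suc (suc m)        ≡⟨ +-suc m (suc m) ⟩
  suc (m + suc m)        ≡⟨ cong suc (+-suc m m) ⟩
  suc (suc (m + m))      ∎
  where open ≡-Reasoning

α-runner₀ : ∀ m r → r ≤ m + m → α (2 + m) 0 r ≡ altTail (suc m) r
α-runner₀ m r r≤ = α-inside (2 + m) 0 r (s≤s z≤n)
  (subst (r <_) (sym (2*[2+m]∸2 m)) (s≤s (≤-trans r≤ (n≤1+n (m + m)))))

α-runner₁ : ∀ m r → r ≤ m + m → α (2 + m) 1 (suc r) ≡ altTail m r
α-runner₁ m r r≤ = α-inside (2 + m) 1 (suc r) (s≤s (s≤s z≤n))
  (subst (suc r <_) (sym (2*[2+m]∸2 m)) (s≤s (s≤s r≤)))

α-shift-down : ∀ m t → 2 + t ≤ m + m → α (2 + m) 0 (2 + t) ≡ α (2 + m) 1 (suc t)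
-- altTail (suc m) (2 + t) reduces to altTail m t.
α-shift-down m t j≤ =
  trans (α-runner₀ m (2 + t) j≤) (sym (α-runner₁ m t (≤-trans (m≤n+m t 2) j≤)))

α-shift-up : ∀ m j → j ≤ m + m → α (2 + m) 0 j ≡ α (2 + m) 1 (j + 1)
α-shift-up m j j≤ = begin
  α (2 + m) 0 j          ≡⟨ α-runner₀ m j j≤ ⟩
  altTail (suc m) j      ≡⟨ altTail-suc m j j≤ ⟩
  altTail m j            ≡⟨ α-runner₁ m j j≤ ⟨
  α (2 + m) 1 (suc j)    ≡⟨ cong (α (2 + m) 1) (+-comm 1 j) ⟩
  α (2 + m) 1 (j + 1)    ∎
  where open ≡-Reasoning

≡⇒≡-⇔ : ∀ {x y : Position} {p : Position} → x ≡ y → (x ≡ p) ⇔ (y ≡ p)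
≡⇒≡-⇔ x≡y = mk⇔ (trans (sym x≡y)) (trans x≡y)

lemma3p5 : (k : ℕ) → 2 ≤ k → (j : ℕ) → 1 < j → j < 2 * k ∸ 3 →
    ((α k 0 j ≡ bead) ⇔ (α k 1 (j ∸ 1) ≡ bead))
    × ((α k (2 * k ∸ 1) j ≡ bead) ⇔ (α k (2 * k ∸ 2) (j ∸ 1) ≡ bead))
    × ((α k 0 j ≡ spacer) ⇔ (α k 1 (j + 1) ≡ spacer))
    × ((α k (2 * k ∸ 1) j ≡ spacer) ⇔ (α k (2 * k ∸ 2) (j + 1) ≡ spacer))
lemma3p5 (suc (suc m)) _ (suc zero) (s≤s ()) _
lemma3p5 (suc (suc m)) _ j@(suc (suc t)) _ j<2k∸3 =
  ≡⇒≡-⇔ (α-shift-down m t j≤) , ≡⇒≡-⇔ (mirrored (α-shift-down m t j≤)) ,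
  ≡⇒≡-⇔ (α-shift-up m j j≤) , ≡⇒≡-⇔ (mirrored (α-shift-up m j j≤))
  where
  j≤ : j ≤ m + m
  j≤ = s≤s⁻¹ (subst (j <_) (cong (_∸ 1) (2*[2+m]∸2 m)) j<2k∸3)
  -- For k = 2 + m, the runner index 2k ∸ 1 ∸ 1 reduces to 2k ∸ 2.
  mirrored : ∀ {r r′} → α (2 + m) 0 r ≡ α (2 + m) 1 r′ →
    α (2 + m) (2 * (2 + m) ∸ 1) r ≡ α (2 + m) (2 * (2 + m) ∸ 2) r′
  mirrored {r} {r′} e =
    trans (α-mirror (2 + m) 0 r (s≤s z≤n))
      (trans e (sym (α-mirror (2 + m) 1 r′ (s≤s (s≤s z≤n)))))
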